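{- Let $k \geq 3$ and $n \geq k+2$. Suppose that $\mathcal{F}$ is a family of $k$-element subsets of $[n]=\{1,2,\ldots,n\}$ such that every $(k,2)$-cluster of $\mathcal{F}$ is intersecting, i.e., for any $A_1,\ldots,A_k\in\mathcal{F}$, $|A_1\cup\cdots\cup A_k|\leq 2k$ implies $A_1\cap\cdots\cap A_k\neq\emptyset$. Then $\mathcal{F}$ contains no $(k-1)$-dimensional simplices.
   Context: A family of $k$-subsets $A_1,\ldots,A_d$ of $[n]$ is called a $(d,c)$-cluster (with $c<d$) if $|A_1\cup\cdots\cup A_d|\leq ck$; a cluster is intersecting if $A_1\cap\cdots\cap A_d\neq\emptyset$. A $d$-dimensional simplex is a family of $d+1$ sets $A_1,\ldots,A_{d+1}$ such that every $d$ of them have a nonempty intersection, but $A_1\cap\cdots\cap A_{d+1}=\emptyset$. -}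

module Defs where

open import Data.Nat using (ℕ; suc; _*_; _≤_)
open import Data.Fin using (Fin; punchIn)
open import Data.Fin.Subset using (Subset; ⋃; ⋂; ∣_∣; Empty; Nonempty; ⊥)
open import Data.Fin.Subset.Properties using ()
open import Data.List using (List)
open import Data.Vec.Functional using (toList)
open import Function.Definitions using (Injective)
open import Relation.Binary.PropositionalEquality using (_≡_)
open import Data.Product using (_×_; Σ)

Family : ℕ → Set₁
Family n = Subset n → Set

⋃ᶠ : ∀ {n d} → (Fin d → Subset n) → Subset n
⋃ᶠ A = ⋃ (toList A)

⋂ᶠ : ∀ {n d} → (Fin d → Subset n) → Subset n
⋂ᶠ A = ⋂ (toList A)

DistinctMembers : ∀ {n} → Family n → (d : ℕ) → (Fin d → Subset n) → Set
DistinctMembers 𝓕 d A = ((i : Fin d) → 𝓕 (A i)) × Injective _≡_ _≡_ A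

IsCluster : ∀ {n} → (k d c : ℕ) → (Fin d → Subset n) → Set
IsCluster k d c A = ((i : Fin d) → ∣ A i ∣ ≡ k) × ∣ ⋃ᶠ A ∣ ≤ c * k

IsIntersecting : ∀ {n d} → (Fin d → Subset n) → Set
IsIntersecting A = Nonempty (⋂ᶠ A)

ClustersIntersecting : ∀ {n} → Family n → (k d c : ℕ) → Set
ClustersIntersecting {n} 𝓕 k d c =
  ∀ (A : Fin d → Subset n) → DistinctMembers 𝓕 d A → IsCluster k d c A → IsIntersecting A

-- A d-dimensional simplex: d+1 sets A_0,…,A_d such that any d of them
-- (all but A_j, indexed via punchIn j) have nonempty intersection, but
-- the intersection of all d+1 is empty.
IsSimplex : ∀ {n} → (d : ℕ) → (Fin (suc d) → Subset n) → Set
IsSimplex d A = ((j : Fin (suc d)) → Nonempty (⋂ᶠ (λ i → A (punchIn j i)))) × Empty (⋂ᶠ A)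

ContainsSimplex : ∀ {n} → Family n → ℕ → Set
ContainsSimplex {n} 𝓕 d = Σ (Fin (suc d) → Subset n) λ A → ((i : Fin (suc d)) → 𝓕 (A i)) × IsSimplex d A

-- In a (k−1)-simplex A₁,…,A_k, the sets other than A_j share a point x_j, and x_j ∉ A_j because the
-- whole family has empty intersection. The x_j are distinct and A_i contains exactly the k−1 of them
-- with j ≠ i, so as |A_i| = k it has at most one further element. Hence |A₁ ∪ ⋯ ∪ A_k| ≤ k + k = 2k:
-- the simplex is a non-intersecting (k,2)-cluster of distinct members of 𝓕.
module Submission where

open import Defs
open import Data.Nat using (ℕ; _≤_; _+_; _*_; _∸_; zero; suc)
open import Data.Nat.Properties using (≤-trans; ≤-reflexive; +-identityʳ; 1+n≰n)
open import Data.Fin using (Fin; zero; suc; punchIn; punchOut; join; splitAt; _≟_)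
open import Data.Fin.Properties using (injective⇒≤; suc-injective; punchIn-injective; punchInᵢ≢i; punchIn-punchOut; splitAt-join; any?)
open import Data.Fin.Subset using (Subset; ∣_∣; _∈_; _∉_; inside; outside)
open import Data.Fin.Subset.Properties using (x∈p∩q⁻; x∈p∩q⁺; x∈p∪q⁻; ∉⊥; ∈⊤)
open import Data.Vec using (_∷_; here; there)
open import Data.Vec.Functional using (Vector) renaming (_∷_ to _◂_)
open import Data.Product using (_,_; proj₁; proj₂; ∃)
open import Data.Sum using (_⊎_; inj₁; inj₂)
open import Data.Empty using (⊥-elim)
open import Function.Definitions using (Injective)
open import Relation.Binary.PropositionalEquality using (_≡_; _≢_; refl; sym; trans; cong; subst)
open import Relation.Nullary using (¬_; Dec; yes; no)

private
  variable
    n m d : ℕ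

x∈⋂ᶠ⁻ : (A : Fin d → Subset n) {x : Fin n} → x ∈ ⋂ᶠ A → ∀ i → x ∈ A i
x∈⋂ᶠ⁻ A x∈ zero    = proj₁ (x∈p∩q⁻ (A zero) _ x∈)
x∈⋂ᶠ⁻ A x∈ (suc i) = x∈⋂ᶠ⁻ (λ j → A (suc j)) (proj₂ (x∈p∩q⁻ (A zero) _ x∈)) i

x∈⋂ᶠ⁺ : (A : Fin d → Subset n) {x : Fin n} → (∀ i → x ∈ A i) → x ∈ ⋂ᶠ A
x∈⋂ᶠ⁺ {d = zero}  A x∈ = ∈⊤
x∈⋂ᶠ⁺ {d = suc d} A x∈ = x∈p∩q⁺ (x∈ zero , x∈⋂ᶠ⁺ (λ j → A (suc j)) (λ i → x∈ (suc i)))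

x∈⋃ᶠ⁻ : (A : Fin d → Subset n) {x : Fin n} → x ∈ ⋃ᶠ A → ∃ λ i → x ∈ A i
x∈⋃ᶠ⁻ {d = zero}  A x∈ = ⊥-elim (∉⊥ x∈)
x∈⋃ᶠ⁻ {d = suc d} A x∈ with x∈p∪q⁻ (A zero) _ x∈
... | inj₁ x∈A₀ = zero , x∈A₀
... | inj₂ x∈⋃ with x∈⋃ᶠ⁻ (λ j → A (suc j)) x∈⋃
...   | i , x∈Aᵢ = suc i , x∈Aᵢ

rank : (p : Subset n) (x : Fin n) → x ∈ p → Fin ∣ p ∣
rank (inside  ∷ p) zero    here      = zero
rank (inside  ∷ p) (suc x) (there x∈) = suc (rank p x x∈)
rank (outside ∷ p) (suc x) (there x∈) = rank p x x∈

unrank : (p : Subset n) → Fin ∣ p ∣ → Fin n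
unrank (inside  ∷ p) zero    = zero
unrank (inside  ∷ p) (suc i) = suc (unrank p i)
unrank (outside ∷ p) i       = suc (unrank p i)

unrank-∈ : (p : Subset n) (i : Fin ∣ p ∣) → unrank p i ∈ p
unrank-∈ (inside  ∷ p) zero    = here
unrank-∈ (inside  ∷ p) (suc i) = there (unrank-∈ p i)
unrank-∈ (outside ∷ p) i       = there (unrank-∈ p i)

unrank-rank : (p : Subset n) (x : Fin n) (x∈ : x ∈ p) → unrank p (rank p x x∈) ≡ x
unrank-rank (inside  ∷ p) zero    here       = refl
unrank-rank (inside  ∷ p) (suc x) (there x∈) = cong suc (unrank-rank p x x∈)
unrank-rank (outside ∷ p) (suc x) (there x∈) = cong suc (unrank-rank p x x∈)

unrank-injective : (p : Subset n) → Injective _≡_ _≡_ (unrank p)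
unrank-injective (inside  ∷ p) {zero}  {zero}  _  = refl
unrank-injective (inside  ∷ p) {suc i} {suc j} eq = cong suc (unrank-injective p (suc-injective eq))
unrank-injective (outside ∷ p)                 eq = unrank-injective p (suc-injective eq)

injective⇒≤∣p∣ : (p : Subset n) (f : Fin m → Fin n) → Injective _≡_ _≡_ f → (∀ i → f i ∈ p) → m ≤ ∣ p ∣
injective⇒≤∣p∣ p f f-inj f∈ = injective⇒≤ {f = λ i → rank p (f i) (f∈ i)} λ {i} {j} eq →
  f-inj (trans (sym (unrank-rank p (f i) (f∈ i))) (trans (cong (unrank p) eq) (unrank-rank p (f j) (f∈ j))))

injective⇒∣p∣≤ : (p : Subset n) (g : (x : Fin n) → x ∈ p → Fin m)
               → (∀ {x y} x∈ y∈ → g x x∈ ≡ g y y∈ → x ≡ y) → ∣ p ∣ ≤ m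
injective⇒∣p∣≤ p g g-inj =
  injective⇒≤ {f = λ i → g (unrank p i) (unrank-∈ p i)} λ eq → unrank-injective p (g-inj _ _ eq)

◂-injective : ∀ {a} {B : Set a} {y : B} {f : Vector B m}
            → (∀ i → y ≢ f i) → Injective _≡_ _≡_ f → Injective _≡_ _≡_ (y ◂ f)
◂-injective y∉f f-inj {zero}  {zero}  _  = refl
◂-injective y∉f f-inj {zero}  {suc j} eq = ⊥-elim (y∉f j eq)
◂-injective y∉f f-inj {suc i} {zero}  eq = ⊥-elim (y∉f i (sym eq))
◂-injective y∉f f-inj {suc i} {suc j} eq = cong suc (f-inj eq)

join-injective : ∀ m n → Injective _≡_ _≡_ (join m n)
join-injective m n {i} {j} eq = trans (sym (splitAt-join m n i)) (trans (cong (splitAt m) eq) (splitAt-join m n j))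

module Simplex (A : Fin (suc d) → Subset n) (simplex : IsSimplex d A) where

  vertex : Fin (suc d) → Fin n
  vertex j = proj₁ (proj₁ simplex j)

  vertex-∈ : ∀ {j i} → j ≢ i → vertex j ∈ A i
  vertex-∈ {j} {i} j≢i = subst (λ t → vertex j ∈ A t) (punchIn-punchOut j≢i)
    (x∈⋂ᶠ⁻ (λ t → A (punchIn j t)) (proj₂ (proj₁ simplex j)) (punchOut j≢i))

  vertex-∉ : ∀ j → vertex j ∉ A j
  vertex-∉ j vⱼ∈Aⱼ = proj₂ simplex (vertex j , x∈⋂ᶠ⁺ A vⱼ∈)
    where
    vⱼ∈ : ∀ i → vertex j ∈ A i
    vⱼ∈ i with i ≟ j
    ... | yes refl = vⱼ∈Aⱼ
    ... | no  i≢j  = vertex-∈ (λ j≡i → i≢j (sym j≡i))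

  vertex-injective : Injective _≡_ _≡_ vertex
  vertex-injective {i} {j} eq with i ≟ j
  ... | yes i≡j = i≡j
  ... | no  i≢j = ⊥-elim (vertex-∉ j (subst (_∈ A j) eq (vertex-∈ i≢j)))

  sets-injective : Injective _≡_ _≡_ A
  sets-injective {i} {j} eq with i ≟ j
  ... | yes i≡j = i≡j
  ... | no  i≢j = ⊥-elim (vertex-∉ i (subst (vertex i ∈_) (sym eq) (vertex-∈ i≢j)))

  NonVertex : Fin n → Set
  NonVertex e = ∀ j → e ≢ vertex j

  module _ (∣A∣≤ : ∀ i → ∣ A i ∣ ≤ suc d) where

    nonVertex-unique : ∀ {i e e′} → e ∈ A i → e′ ∈ A i → NonVertex e → NonVertex e′ → e ≡ e′
    nonVertex-unique {i} {e} {e′} e∈ e′∈ e-nv e′-nv with e ≟ e′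
    ... | yes e≡e′ = e≡e′
    ... | no  e≢e′ = ⊥-elim (1+n≰n (≤-trans (injective⇒≤∣p∣ (A i) elements elements-injective elements-∈) (∣A∣≤ i)))
      where
      elements : Vector (Fin n) (suc (suc d))
      elements = e ◂ (e′ ◂ λ j → vertex (punchIn i j))

      elements-injective : Injective _≡_ _≡_ elements
      elements-injective = ◂-injective e-distinct (◂-injective (λ j → e′-nv (punchIn i j))
                             λ eq → punchIn-injective i _ _ (vertex-injective eq))
        where
        e-distinct : ∀ j → e ≢ (e′ ◂ λ j → vertex (punchIn i j)) j
        e-distinct zero    = e≢e′
        e-distinct (suc j) = e-nv (punchIn i j)

      elements-∈ : ∀ j → elements j ∈ A i
      elements-∈ zero          = e∈
      elements-∈ (suc zero)    = e′∈
      elements-∈ (suc (suc j)) = vertex-∈ (punchInᵢ≢i i j)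

    label : (e : Fin n) → e ∈ ⋃ᶠ A → Dec (∃ λ j → e ≡ vertex j) → Fin (suc d) ⊎ Fin (suc d)
    label e e∈ (yes (j , _)) = inj₁ j
    label e e∈ (no  _)       = inj₂ (proj₁ (x∈⋃ᶠ⁻ A e∈))

    label-injective : ∀ {e e′} e∈ e′∈ v? v′? → label e e∈ v? ≡ label e′ e′∈ v′? → e ≡ e′
    label-injective _ _ (yes (j , refl)) (yes (.j , refl)) refl = refl
    label-injective e∈ e′∈ (no e-nv) (no e′-nv) eq with x∈⋃ᶠ⁻ A e∈ | x∈⋃ᶠ⁻ A e′∈
    label-injective e∈ e′∈ (no e-nv) (no e′-nv) refl | i , eᵢ∈ | .i , e′ᵢ∈ =
      nonVertex-unique eᵢ∈ e′ᵢ∈ (λ j eq → e-nv (j , eq)) (λ j eq → e′-nv (j , eq))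

    ∣⋃ᶠ∣≤2* : ∣ ⋃ᶠ A ∣ ≤ 2 * suc d
    ∣⋃ᶠ∣≤2* = subst (λ t → ∣ ⋃ᶠ A ∣ ≤ suc d + t) (sym (+-identityʳ (suc d)))
      (injective⇒∣p∣≤ (⋃ᶠ A) (λ e e∈ → join _ _ (label e e∈ (isVertex? e)))
        λ e∈ e′∈ eq → label-injective e∈ e′∈ (isVertex? _) (isVertex? _) (join-injective _ _ eq))
      where
      isVertex? : (e : Fin n) → Dec (∃ λ j → e ≡ vertex j)
      isVertex? e = any? (λ j → e ≟ vertex j)

theorem2p1 : (k n : ℕ) → 3 ≤ k → k + 2 ≤ n → (𝓕 : Family n)
    → ((A : Subset n) → 𝓕 A → ∣ A ∣ ≡ k)
    → ClustersIntersecting 𝓕 k k 2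
    → ¬ ContainsSimplex 𝓕 (k ∸ 1)
theorem2p1 (suc d) n _ _ 𝓕 ∣𝓕∣≡k clusters (A , A∈𝓕 , simplex) =
  proj₂ simplex (clusters A (A∈𝓕 , sets-injective) (∣A∣≡k , ∣⋃ᶠ∣≤2* (λ i → ≤-reflexive (∣A∣≡k i))))
  where
  open Simplex A simplex
  ∣A∣≡k : ∀ i → ∣ A i ∣ ≡ suc d
  ∣A∣≡k i = ∣𝓕∣≡k (A i) (A∈𝓕 i)
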